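{- For all natural numbers $a, b \geq 1$, $$\gcd(a,b) = \left( \left\lfloor \frac{5^{ab(ab+a+b)}}{(5^{a^2 b}-1)(5^{ab^2}-1)} \right\rfloor \bmod 5^{ab} \right) - 1.$$
   Context: $\gcd(a,b)$ denotes the greatest common divisor of $a$ and $b$. For integers $x$ and $m \geq 1$, $x \bmod m$ denotes the least non-negative residue of $x$ modulo $m$, i.e. the unique $r \in \{0,\dots,m-1\}$ with $m \mid x - r$; $\lfloor \cdot \rfloor$ is the floor function. -}

module Defs where

open import Data.Nat using (ℕ; zero; suc; _+_; _*_; _∸_; _^_; _≤_; _<_; NonZero; s≤s; z≤n; >-nonZero)
open import Data.Nat.Properties using (m^n≢0; m^n>0; *-mono-≤; ≤-trans; m≤m*n; *-monoʳ-≤)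

private
  lemma : ∀ n → 1 < 5 ^ suc n
  lemma n = ≤-trans (s≤s (s≤s z≤n)) (*-monoʳ-≤ 5 (m^n>0 5 n))

5^n∸1-nonZero : ∀ n → 1 ≤ n → NonZero (5 ^ n ∸ 1)
5^n∸1-nonZero (suc n) _ with 5 ^ suc n | lemma n
... | suc (suc k) | _ = _
... | suc zero | s≤s ()

*-nz : ∀ m n → NonZero m → NonZero n → NonZero (m * n)
*-nz (suc m) (suc n) _ _ = _

denom-nonZero : ∀ a b → 1 ≤ a → 1 ≤ b → NonZero ((5 ^ (a * a * b) ∸ 1) * (5 ^ (a * b * b) ∸ 1))
denom-nonZero (suc a) (suc b) _ _ =
  *-nz _ _ (5^n∸1-nonZero (suc a * suc a * suc b) (s≤s z≤n))
           (5^n∸1-nonZero (suc a * suc b * suc b) (s≤s z≤n))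

mod-nonZero : ∀ a b → NonZero (5 ^ (a * b))
mod-nonZero a b = m^n≢0 5 (a * b)

-- Put y = 5^(ab), n = ab + a + b and e t = ab + b - a t, so the quantity is
-- ⌊y^n / ((y^a - 1)(y^b - 1))⌋ mod y.  Dividing y^n by y^a - 1 sums a geometric
-- series: the quotient is F = Σ_{t<K} y^(e t) with K = ⌊n/a⌋, the remainder
-- y^(n mod a).  Modulo y^b - 1 every y^(e t) reduces to y^(e t mod b), and the sum
-- S of these is already below y^b - 1; hence F = S + Q (y^b - 1), where Q is the
-- floor in question.  Reading F + Q = S + Q y^b modulo y, where y^e ≡ [e = 0],
-- gives Q ≡ #{t < K : e t > 0, b ∣ e t}.  Now b ∣ e t exactly when b / gcd(a,b) ∣ t,
-- and e t > 0 forces t ≤ b for such t, so the count is the number of multiples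
-- of b / gcd(a,b) in [0, b], namely gcd(a,b) + 1.
module Submission where

open import Defs
open import Data.Nat using (ℕ; _+_; _*_; _∸_; _^_; _≤_)
open import Data.Nat.DivMod using (_/_; _%_)
open import Data.Nat.GCD using (gcd)
open import Relation.Binary.PropositionalEquality using (_≡_)

open import Data.Nat
open import Data.Nat.Properties
open import Data.Nat.DivMod
open import Data.Nat.Divisibility
open import Data.Nat.GCD
open import Data.Nat.Coprimality using (coprime-/gcd; coprime-divisor)
import Data.Nat.Coprimality as Coprimality
open import Data.Nat.Tactic.RingSolver using (solve-∀)
open import Algebra.Properties.CommutativeSemigroup +-commutativeSemigroup
  using () renaming (interchange to +-interchange)
open import Data.Sum using (inj₁; inj₂)
open import Relation.Nullary using (contradiction)
open import Relation.Binary.PropositionalEquality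

∑ : ℕ → (ℕ → ℕ) → ℕ
∑ zero    f = 0
∑ (suc K) f = ∑ K f + f K

infix 5 ∑
syntax ∑ K (λ t → e) = ∑[ t < K ] e

∑-cong : ∀ K {f g : ℕ → ℕ} → (∀ t → t < K → f t ≡ g t) → ∑ K f ≡ ∑ K g
∑-cong zero    eq = refl
∑-cong (suc K) eq = cong₂ _+_ (∑-cong K (λ t t<K → eq t (m<n⇒m<1+n t<K))) (eq K (n<1+n K))

∑-distrib-+ : ∀ K (f g : ℕ → ℕ) → ∑[ t < K ] (f t + g t) ≡ ∑ K f + ∑ K g
∑-distrib-+ zero    f g = refl
∑-distrib-+ (suc K) f g = begin
  (∑[ t < K ] (f t + g t)) + (f K + g K) ≡⟨ cong (_+ (f K + g K)) (∑-distrib-+ K f g) ⟩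
  ∑ K f + ∑ K g + (f K + g K)             ≡⟨ +-interchange (∑ K f) (∑ K g) (f K) (g K) ⟩
  ∑ K f + f K + (∑ K g + g K)             ∎
  where open ≡-Reasoning

∑-split : ∀ m j (f : ℕ → ℕ) → ∑ (m + j) f ≡ ∑ m f + (∑[ i < j ] f (m + i))
∑-split m zero    f = trans (cong (λ L → ∑ L f) (+-identityʳ m)) (sym (+-identityʳ (∑ m f)))
∑-split m (suc j) f = begin
  ∑ (m + suc j) f                             ≡⟨ cong (λ L → ∑ L f) (+-suc m j) ⟩
  ∑ (m + j) f + f (m + j)                     ≡⟨ cong (_+ f (m + j)) (∑-split m j f) ⟩
  ∑ m f + (∑[ i < j ] f (m + i)) + f (m + j)  ≡⟨ +-assoc (∑ m f) _ _ ⟩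
  ∑ m f + (∑[ i < suc j ] f (m + i))          ∎
  where open ≡-Reasoning

∑-trailing-zeros : ∀ {K L} {f : ℕ → ℕ} → K ≤ L → (∀ t → K ≤ t → t < L → f t ≡ 0) → ∑ L f ≡ ∑ K f
∑-trailing-zeros {L = zero}  z≤n  zeros = refl
∑-trailing-zeros {K} {suc L} {f} K≤1+L zeros with m≤n⇒m<n∨m≡n K≤1+L
... | inj₂ refl  = refl
... | inj₁ K≤L = begin
  ∑ L f + f L ≡⟨ cong₂ _+_ (∑-trailing-zeros (s≤s⁻¹ K≤L) (λ t K≤t t<L → zeros t K≤t (m<n⇒m<1+n t<L)))
                            (zeros L (s≤s⁻¹ K≤L) (n<1+n L)) ⟩
  ∑ K f + 0   ≡⟨ +-identityʳ (∑ K f) ⟩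
  ∑ K f       ∎
  where open ≡-Reasoning

∑-≤ : ∀ K {f : ℕ → ℕ} {c} → (∀ t → t < K → f t ≤ c) → ∑ K f ≤ K * c
∑-≤ zero    le = z≤n
∑-≤ (suc K) {f} {c} le = begin
  ∑ K f + f K ≤⟨ +-mono-≤ (∑-≤ K (λ t t<K → le t (m<n⇒m<1+n t<K))) (le K (n<1+n K)) ⟩
  K * c + c   ≡⟨ +-comm (K * c) c ⟩
  suc K * c   ∎
  where open ≤-Reasoning

module _ {m : ℕ} .{{_ : NonZero m}} where

  +-cong-% : ∀ {x x′ z z′} → x % m ≡ x′ % m → z % m ≡ z′ % m → (x + z) % m ≡ (x′ + z′) % m
  +-cong-% {x} {x′} {z} {z′} x≈x′ z≈z′ = begin
    (x + z) % m           ≡⟨ %-distribˡ-+ x z m ⟩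
    (x % m + z % m) % m   ≡⟨ cong₂ (λ r s → (r + s) % m) x≈x′ z≈z′ ⟩
    (x′ % m + z′ % m) % m ≡⟨ %-distribˡ-+ x′ z′ m ⟨
    (x′ + z′) % m         ∎
    where open ≡-Reasoning

  *-cong-% : ∀ {x x′ z z′} → x % m ≡ x′ % m → z % m ≡ z′ % m → (x * z) % m ≡ (x′ * z′) % m
  *-cong-% {x} {x′} {z} {z′} x≈x′ z≈z′ = begin
    (x * z) % m             ≡⟨ %-distribˡ-* x z m ⟩
    (x % m * (z % m)) % m   ≡⟨ cong₂ (λ r s → (r * s) % m) x≈x′ z≈z′ ⟩
    (x′ % m * (z′ % m)) % m ≡⟨ %-distribˡ-* x′ z′ m ⟨
    (x′ * z′) % m           ∎
    where open ≡-Reasoning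

  ^-cong-% : ∀ {x x′} k → x % m ≡ x′ % m → x ^ k % m ≡ x′ ^ k % m
  ^-cong-% zero    x≈x′ = refl
  ^-cong-% (suc k) x≈x′ = *-cong-% x≈x′ (^-cong-% k x≈x′)

  ∑-cong-% : ∀ K {f g : ℕ → ℕ} → (∀ t → t < K → f t % m ≡ g t % m) → ∑ K f % m ≡ ∑ K g % m
  ∑-cong-% zero    eq = refl
  ∑-cong-% (suc K) eq = +-cong-% (∑-cong-% K (λ t t<K → eq t (m<n⇒m<1+n t<K))) (eq K (n<1+n K))

  -- Adding (m - 1) c turns a leading c into the multiple m c.
  +-cancelˡ-% : ∀ c {x z} → (c + x) % m ≡ (c + z) % m → x % m ≡ z % m
  +-cancelˡ-% c {x} {z} eq = begin
    x % m                    ≡⟨ [m+kn]%n≡m%n x c m ⟨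
    (x + c * m) % m          ≡⟨ %-congˡ (shift x) ⟩
    (c + x + pred m * c) % m ≡⟨ +-cong-% eq refl ⟩
    (c + z + pred m * c) % m ≡⟨ %-congˡ (shift z) ⟨
    (z + c * m) % m          ≡⟨ [m+kn]%n≡m%n z c m ⟩
    z % m                    ∎
    where
    open ≡-Reasoning
    shift : ∀ w → w + c * m ≡ c + w + pred m * c
    shift w = begin
      w + c * m              ≡⟨ cong (λ k → w + c * k) (suc-pred m) ⟨
      w + c * (1 + pred m)   ≡⟨ ring w c (pred m) ⟩
      c + w + pred m * c     ∎
      where
      ring : ∀ w c p → w + c * (1 + p) ≡ c + w + p * c
      ring = solve-∀

δ₀ : ℕ → ℕ
δ₀ zero    = 1
δ₀ (suc _) = 0

δ₀-cong : ∀ {x z} → (x ≡ 0 → z ≡ 0) → (z ≡ 0 → x ≡ 0) → δ₀ x ≡ δ₀ z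
δ₀-cong {zero}  {zero}  _   _   = refl
δ₀-cong {zero}  {suc _} x≡0 _   with () ← x≡0 refl
δ₀-cong {suc _} {zero}  _   z≡0 with () ← z≡0 refl
δ₀-cong {suc _} {suc _} _   _   = refl

δ₀[0%d]≡1 : ∀ d .{{_ : NonZero d}} → δ₀ (0 % d) ≡ 1
δ₀[0%d]≡1 d = cong δ₀ (m*n%n≡0 0 d)

δ₀≤δ₀[%] : ∀ x d .{{_ : NonZero d}} → δ₀ x ≤ δ₀ (x % d)
δ₀≤δ₀[%] zero    d = ≤-reflexive (sym (δ₀[0%d]≡1 d))
δ₀≤δ₀[%] (suc x) d = z≤n

δ₀[x%d]∸δ₀x≡δ₀[x%d] : ∀ {x} d .{{_ : NonZero d}} → 0 < x → δ₀ (x % d) ∸ δ₀ x ≡ δ₀ (x % d)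
δ₀[x%d]∸δ₀x≡δ₀[x%d] {suc x} d _ = refl

δ₀[%]-cong : ∀ {x d z d′} .{{_ : NonZero d}} .{{_ : NonZero d′}} →
             (d ∣ x → d′ ∣ z) → (d′ ∣ z → d ∣ x) → δ₀ (x % d) ≡ δ₀ (z % d′)
δ₀[%]-cong {x} {d} {z} {d′} ⇒ ⇐ = δ₀-cong
  (λ x%d≡0 → n∣m⇒m%n≡0 z d′ (⇒ (m%n≡0⇒n∣m x d x%d≡0)))
  (λ z%d′≡0 → n∣m⇒m%n≡0 x d (⇐ (m%n≡0⇒n∣m z d′ z%d′≡0)))

m^n%m≡δ₀n%m : ∀ m .{{_ : NonZero m}} n → m ^ n % m ≡ δ₀ n % m
m^n%m≡δ₀n%m m zero    = refl
m^n%m≡δ₀n%m m (suc n) = trans (n∣m⇒m%n≡0 _ m (m∣m*n (m ^ n))) (sym (m*n%n≡0 0 m))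

-- y^b ≡ 1, hence y^e ≡ y^(e mod b), modulo y^b - 1.
y^e%[y^b∸1]≡y^[e%b] : ∀ y b e .{{_ : NonZero b}} .{{_ : NonZero (y ^ b ∸ 1)}} →
                      y ^ e % (y ^ b ∸ 1) ≡ y ^ (e % b) % (y ^ b ∸ 1)
y^e%[y^b∸1]≡y^[e%b] y b e = begin
  y ^ e % w                               ≡⟨ %-congˡ (cong (y ^_) (m≡m%n+[m/n]*n e b)) ⟩
  y ^ (e % b + e / b * b) % w             ≡⟨ %-congˡ (^-distribˡ-+-* y (e % b) (e / b * b)) ⟩
  y ^ (e % b) * y ^ (e / b * b) % w       ≡⟨ %-congˡ (cong (λ k → y ^ (e % b) * y ^ k) (*-comm (e / b) b)) ⟩
  y ^ (e % b) * y ^ (b * (e / b)) % w     ≡⟨ %-congˡ (cong (y ^ (e % b) *_) (^-*-assoc y b (e / b))) ⟨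
  y ^ (e % b) * (y ^ b) ^ (e / b) % w     ≡⟨ *-cong-% {x = y ^ (e % b)} refl (^-cong-% (e / b) y^b≈1) ⟩
  y ^ (e % b) * 1 ^ (e / b) % w           ≡⟨ %-congˡ (cong (y ^ (e % b) *_) (^-zeroˡ (e / b))) ⟩
  y ^ (e % b) * 1 % w                     ≡⟨ %-congˡ (*-identityʳ (y ^ (e % b))) ⟩
  y ^ (e % b) % w                         ∎
  where
  open ≡-Reasoning
  w = y ^ b ∸ 1
  y^b≈1 : y ^ b % w ≡ 1 % w
  y^b≈1 = trans (%-congˡ (sym (m+[n∸m]≡n {1} (<⇒≤ (m∸n≢0⇒n<m (≢-nonZero⁻¹ w)))))) ([m+n]%n≡m%n 1 w)

m<n⇒[m+kn]/n≡k : ∀ {m} k {n} .{{_ : NonZero n}} → m < n → (m + k * n) / n ≡ k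
m<n⇒[m+kn]/n≡k {m} k {n} m<n = begin
  (m + k * n) / n   ≡⟨ +-distrib-/-∣ʳ m (n∣m*n k) ⟩
  m / n + k * n / n ≡⟨ cong₂ _+_ (m<n⇒m/n≡0 m<n) (m*n/n≡m k n) ⟩
  k                 ∎
  where open ≡-Reasoning

m*[1+n]≤o⇒o∸m*n≡o∸m*[1+n]+m : ∀ m n o → m * suc n ≤ o → o ∸ m * n ≡ o ∸ m * suc n + m
m*[1+n]≤o⇒o∸m*n≡o∸m*[1+n]+m m n o le = begin
  o ∸ m * n                    ≡⟨ cong (_∸ m * n) (m∸n+n≡m le) ⟨
  r + m * suc n ∸ m * n        ≡⟨ cong (λ k → r + k ∸ m * n) (*-suc m n) ⟩
  r + (m + m * n) ∸ m * n      ≡⟨ cong (_∸ m * n) (+-assoc r m (m * n)) ⟨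
  r + m + m * n ∸ m * n        ≡⟨ m+n∸n≡m (r + m) (m * n) ⟩
  r + m                        ∎
  where
  open ≡-Reasoning
  r = o ∸ m * suc n

∑-geometric : ∀ y .{{_ : NonZero y}} a n K → a * K ≤ n →
              y ^ n ≡ y ^ (n ∸ a * K) + (∑[ t < K ] y ^ (n ∸ a * suc t)) * (y ^ a ∸ 1)
∑-geometric y a n zero    _    = begin
  y ^ n                     ≡⟨ cong (λ k → y ^ (n ∸ k)) (*-zeroʳ a) ⟨
  y ^ (n ∸ a * 0)           ≡⟨ +-identityʳ _ ⟨
  y ^ (n ∸ a * 0) + 0       ∎
  where open ≡-Reasoning
∑-geometric y a n (suc K) aK≤n = begin
  y ^ n                        ≡⟨ ∑-geometric y a n K (≤-trans (*-monoʳ-≤ a (n≤1+n K)) aK≤n) ⟩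
  y ^ (n ∸ a * K) + S * w      ≡⟨ cong (λ k → y ^ k + S * w) (m*[1+n]≤o⇒o∸m*n≡o∸m*[1+n]+m a K n aK≤n) ⟩
  y ^ (r + a) + S * w          ≡⟨ cong (_+ S * w) (^-distribˡ-+-* y r a) ⟩
  y ^ r * y ^ a + S * w        ≡⟨ cong (λ k → y ^ r * k + S * w) (m+[n∸m]≡n {1} (m^n>0 y a)) ⟨
  y ^ r * (1 + w) + S * w      ≡⟨ ring (y ^ r) S w ⟩
  y ^ r + (S + y ^ r) * w      ∎
  where
  open ≡-Reasoning
  r = n ∸ a * suc K
  S = ∑[ t < K ] y ^ (n ∸ a * suc t)
  w = y ^ a ∸ 1
  ring : ∀ p S w → p * (1 + w) + S * w ≡ p + (S + p) * w
  ring = solve-∀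

∑y^[f%d]<y^d∸1 : ∀ {y} K d (f : ℕ → ℕ) .{{_ : NonZero d}} → K + 2 ≤ y →
                 ∑[ t < K ] y ^ (f t % d) < y ^ d ∸ 1
∑y^[f%d]<y^d∸1 {y} K (suc d) f K+2≤y = m+n≤o⇒m≤o∸n _ (begin
  suc (∑[ t < K ] y ^ (f t % suc d)) + 1 ≡⟨ +-comm (suc (∑[ t < K ] y ^ (f t % suc d))) 1 ⟩
  2 + (∑[ t < K ] y ^ (f t % suc d))     ≤⟨ +-mono-≤ (*-monoʳ-≤ 2 (m^n>0 y d)) (∑-≤ K each≤y^d) ⟩
  2 * y ^ d + K * y ^ d                  ≡⟨ *-distribʳ-+ (y ^ d) 2 K ⟨
  (2 + K) * y ^ d                        ≤⟨ *-monoˡ-≤ (y ^ d) (≤-trans (≤-reflexive (+-comm 2 K)) K+2≤y) ⟩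
  y ^ suc d                              ∎)
  where
  open ≤-Reasoning
  instance
    y≢0 : NonZero y
    y≢0 = >-nonZero (≤-trans (s≤s z≤n) (≤-trans (m≤n+m 2 K) K+2≤y))
  each≤y^d : ∀ t → t < K → y ^ (f t % suc d) ≤ y ^ d
  each≤y^d t _ = ^-monoʳ-≤ y (s≤s⁻¹ (m%n<n (f t) (suc d)))

3n+2≤5^n : ∀ n .{{_ : NonZero n}} → 3 * n + 2 ≤ 5 ^ n
3n+2≤5^n 1               = ≤-refl
3n+2≤5^n (suc n@(suc _)) = begin
  3 * suc n + 2     ≡⟨ ring n ⟩
  3 + (3 * n + 2)   ≤⟨ +-monoʳ-≤ 3 (3n+2≤5^n n) ⟩
  3 + 5 ^ n         ≤⟨ +-monoˡ-≤ (5 ^ n) (≤-trans (n≤1+n 3) (*-monoʳ-≤ 4 (m^n>0 5 n))) ⟩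
  4 * 5 ^ n + 5 ^ n ≡⟨ +-comm (4 * 5 ^ n) (5 ^ n) ⟩
  5 ^ suc n         ∎
  where
  open ≤-Reasoning
  ring : ∀ n → 3 * (1 + n) + 2 ≡ 3 + (3 * n + 2)
  ring = solve-∀

∑δ₀[t%q]≡1+s : ∀ q s .{{_ : NonZero q}} → ∑[ t < suc (s * q) ] δ₀ (t % q) ≡ suc s
∑δ₀[t%q]≡1+s q@(suc p) zero    = refl
∑δ₀[t%q]≡1+s q@(suc p) (suc s) = begin
  ∑ (suc (suc s * q)) f
    ≡⟨ cong (λ L → ∑ (suc L) f) (+-comm q (s * q)) ⟩
  ∑ (suc (s * q) + q) f
    ≡⟨ ∑-split (suc (s * q)) q f ⟩
  ∑ (suc (s * q)) f + (∑[ i < q ] f (suc (s * q) + i))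
    ≡⟨ +-assoc (∑ (suc (s * q)) f) _ _ ⟨
  ∑ (suc (s * q)) f + (∑[ i < p ] f (suc (s * q) + i)) + f (suc (s * q) + p)
    ≡⟨ cong₂ (λ α β → ∑ (suc (s * q)) f + α + β) (∑-trailing-zeros z≤n before-multiple) at-multiple ⟩
  ∑ (suc (s * q)) f + 0 + 1
    ≡⟨ cong (λ α → α + 0 + 1) (∑δ₀[t%q]≡1+s q s) ⟩
  suc s + 0 + 1
    ≡⟨ cong (_+ 1) (+-identityʳ (suc s)) ⟩
  suc s + 1
    ≡⟨ +-comm (suc s) 1 ⟩
  suc (suc s)
    ∎
  where
  open ≡-Reasoning
  f = λ t → δ₀ (t % q)
  before-multiple : ∀ i → 0 ≤ i → i < p → f (suc (s * q) + i) ≡ 0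
  before-multiple i _ i<p = cong δ₀ (begin
    (suc (s * q) + i) % q ≡⟨ cong (_% q) (+-comm (suc (s * q)) i) ⟩
    (i + suc (s * q)) % q ≡⟨ cong (_% q) (+-suc i (s * q)) ⟩
    (suc i + s * q) % q   ≡⟨ [m+kn]%n≡m%n (suc i) s q ⟩
    suc i % q             ≡⟨ m<n⇒m%n≡m (s≤s i<p) ⟩
    suc i                 ∎)
  at-multiple : f (suc (s * q) + p) ≡ 1
  at-multiple = cong δ₀ (begin
    (suc (s * q) + p) % q ≡⟨ cong (_% q) (+-comm (suc (s * q)) p) ⟩
    (p + suc (s * q)) % q ≡⟨ cong (_% q) (+-suc p (s * q)) ⟩
    (q + s * q) % q       ≡⟨ m*n%n≡0 (suc s) q ⟩
    0                     ∎)

n∣m*t⇒n/gcd[m,n]∣t : ∀ m n t .{{_ : NonZero (gcd m n)}} → n ∣ m * t → n / gcd m n ∣ t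
n∣m*t⇒n/gcd[m,n]∣t m n t n∣mt = coprime-divisor (Coprimality.sym (coprime-/gcd m n))
  (*-cancelʳ-∣ (gcd m n) (subst₂ _∣_ (sym (m/n*n≡m (gcd[m,n]∣n m n))) reassoc n∣mt))
  where
  reassoc : m * t ≡ m / gcd m n * t * gcd m n
  reassoc = begin
    m * t                         ≡⟨ cong (_* t) (m/n*n≡m (gcd[m,n]∣m m n)) ⟨
    m / gcd m n * gcd m n * t     ≡⟨ *-assoc (m / gcd m n) (gcd m n) t ⟩
    m / gcd m n * (gcd m n * t)   ≡⟨ cong (m / gcd m n *_) (*-comm (gcd m n) t) ⟩
    m / gcd m n * (t * gcd m n)   ≡⟨ *-assoc (m / gcd m n) t (gcd m n) ⟨
    m / gcd m n * t * gcd m n     ∎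
    where open ≡-Reasoning

n/gcd[m,n]∣t⇒n∣m*t : ∀ m n t .{{_ : NonZero (gcd m n)}} → n / gcd m n ∣ t → n ∣ m * t
n/gcd[m,n]∣t⇒n∣m*t m n t n′∣t =
  subst₂ _∣_ (m/n*n≡m (gcd[m,n]∣n m n)) (*-comm t m) (*-pres-∣ n′∣t (gcd[m,n]∣m m n))

∣m∸n∣m⇒∣n : ∀ {d m n} → n ≤ m → d ∣ m ∸ n → d ∣ m → d ∣ n
∣m∸n∣m⇒∣n n≤m d∣m∸n d∣m = ∣m+n∣m⇒∣n (subst (_ ∣_) (sym (m∸n+n≡m n≤m)) d∣m) d∣m∸n

∣m∣n⇒∣m∸n : ∀ {d m n} → n ≤ m → d ∣ m → d ∣ n → d ∣ m ∸ n
∣m∣n⇒∣m∸n n≤m d∣m d∣n = ∣m+n∣m⇒∣n (subst (_ ∣_) (sym (m+[n∸m]≡n n≤m)) d∣m) d∣n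

module MultiplesCount (a b : ℕ) {{_ : NonZero a}} {{_ : NonZero b}} where

  g : ℕ
  g = gcd a b

  instance
    g≢0 : NonZero g
    g≢0 = ≢-nonZero (gcd[m,n]≢0 a b (inj₁ (≢-nonZero⁻¹ a)))

  b′ : ℕ
  b′ = b / g

  instance
    b′≢0 : NonZero b′
    b′≢0 = ≢-nonZero (n/gcd[m,n]≢0 a b)

  g*b′≡b : g * b′ ≡ b
  g*b′≡b = m*[n/m]≡n (gcd[m,n]∣n a b)

  e : ℕ → ℕ
  e t = a * b + b ∸ a * t

  -- The indicator of 0 < e t and b ∣ e t.
  c : ℕ → ℕ
  c t = δ₀ (e t % b) ∸ δ₀ (e t)

  b∣ab+b : b ∣ a * b + b
  b∣ab+b = ∣m∣n⇒∣m+n (n∣m*n a) ∣-refl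

  b∣e⇒b′∣ : ∀ t → a * t ≤ a * b + b → b ∣ e t → b′ ∣ t
  b∣e⇒b′∣ t at≤ b∣e = n∣m*t⇒n/gcd[m,n]∣t a b t (∣m∸n∣m⇒∣n at≤ b∣e b∣ab+b)

  b′∣⇒b∣e : ∀ t → a * t ≤ a * b + b → b′ ∣ t → b ∣ e t
  b′∣⇒b∣e t at≤ b′∣t = ∣m∣n⇒∣m∸n at≤ b∣ab+b (n/gcd[m,n]∣t⇒n∣m*t a b t b′∣t)

  multiple-beyond-b : ∀ t → b < t → b′ ∣ t → a * b + b ≤ a * t
  multiple-beyond-b t b<t (divides w t≡w*b′) = begin
    a * b + b               ≡⟨ cong (λ k → a * k + k) g*b′≡b ⟨
    a * (g * b′) + g * b′   ≤⟨ +-monoʳ-≤ (a * (g * b′)) (*-monoˡ-≤ b′ (∣⇒≤ (gcd[m,n]∣m a b))) ⟩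
    a * (g * b′) + a * b′   ≡⟨ ring a g b′ ⟩
    a * (suc g * b′)        ≤⟨ *-monoʳ-≤ a (*-monoˡ-≤ b′ g<w) ⟩
    a * (w * b′)            ≡⟨ cong (a *_) t≡w*b′ ⟨
    a * t                   ∎
    where
    open ≤-Reasoning
    g<w : g < w
    g<w = *-cancelʳ-< b′ g w (subst₂ _<_ (sym g*b′≡b) t≡w*b′ b<t)
    ring : ∀ a g b′ → a * (g * b′) + a * b′ ≡ a * ((1 + g) * b′)
    ring = solve-∀

  c-low : ∀ t → t ≤ b → c t ≡ δ₀ (t % b′)
  c-low t t≤b = begin
    c t          ≡⟨ δ₀[x%d]∸δ₀x≡δ₀[x%d] b (m<n⇒0<n∸m at<ab+b) ⟩
    δ₀ (e t % b) ≡⟨ δ₀[%]-cong (b∣e⇒b′∣ t (<⇒≤ at<ab+b)) (b′∣⇒b∣e t (<⇒≤ at<ab+b)) ⟩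
    δ₀ (t % b′)  ∎
    where
    open ≡-Reasoning
    at<ab+b : a * t < a * b + b
    at<ab+b = ≤-<-trans (*-monoʳ-≤ a t≤b) (m<m+n (a * b) (>-nonZero⁻¹ b))

  c-high : ∀ t → b < t → c t ≡ 0
  c-high t b<t with e t in e≡
  ... | zero  = cong (_∸ 1) (δ₀[0%d]≡1 b)
  ... | suc x with suc x % b in x%b
  ...   | suc _ = refl
  ...   | zero  = contradiction (multiple-beyond-b t b<t b′∣t) (<⇒≱ at<ab+b)
    where
    at<ab+b : a * t < a * b + b
    at<ab+b = m∸n≢0⇒n<m (λ e≡0 → 1+n≢0 (trans (sym e≡) e≡0))
    b′∣t : b′ ∣ t
    b′∣t = b∣e⇒b′∣ t (<⇒≤ at<ab+b) (subst (b ∣_) (sym e≡) (m%n≡0⇒n∣m (suc x) b x%b))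

  ∑c≡1+g : ∀ K → b < K → ∑ K c ≡ suc g
  ∑c≡1+g K b<K = begin
    ∑ K c                             ≡⟨ ∑-trailing-zeros b<K (λ t b<t _ → c-high t b<t) ⟩
    ∑ (suc b) c                       ≡⟨ ∑-cong (suc b) (λ t t<1+b → c-low t (s≤s⁻¹ t<1+b)) ⟩
    ∑[ t < suc b ] δ₀ (t % b′)        ≡⟨ cong (λ L → ∑[ t < suc L ] δ₀ (t % b′)) g*b′≡b ⟨
    ∑[ t < suc (g * b′) ] δ₀ (t % b′) ≡⟨ ∑δ₀[t%q]≡1+s b′ g ⟩
    suc g                             ∎
    where open ≡-Reasoning

module Floor (a b : ℕ) {{_ : NonZero a}} {{_ : NonZero b}} where
  open MultiplesCount a b using (g; e; c; ∑c≡1+g)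

  y n K : ℕ
  y = 5 ^ (a * b)
  n = a * b + a + b
  K = n / a

  instance
    y≢0 : NonZero y
    y≢0 = m^n≢0 5 (a * b)

  F S I Q : ℕ
  F = ∑[ t < K ] y ^ e t
  S = ∑[ t < K ] y ^ (e t % b)
  I = ∑[ t < K ] δ₀ (e t)

  n∸a*[1+t]≡e : ∀ t → n ∸ a * suc t ≡ e t
  n∸a*[1+t]≡e t = begin
    n ∸ a * suc t               ≡⟨ cong (n ∸_) (*-suc a t) ⟩
    n ∸ (a + a * t)             ≡⟨ ∸-+-assoc n a (a * t) ⟨
    n ∸ a ∸ a * t               ≡⟨ cong (λ k → k ∸ a ∸ a * t) (ring a b) ⟩
    a + (a * b + b) ∸ a ∸ a * t ≡⟨ cong (_∸ a * t) (m+n∸m≡n a (a * b + b)) ⟩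
    e t                         ∎
    where
    open ≡-Reasoning
    ring : ∀ a b → a * b + a + b ≡ a + (a * b + b)
    ring = solve-∀

  K+2≤y : K + 2 ≤ y
  K+2≤y = begin
    K + 2                     ≤⟨ +-monoˡ-≤ 2 (m/n≤m n a) ⟩
    a * b + a + b + 2         ≤⟨ +-monoˡ-≤ 2 (+-mono-≤ (+-monoʳ-≤ (a * b) (m≤m*n a b)) (m≤n*m b a)) ⟩
    a * b + a * b + a * b + 2 ≡⟨ cong (_+ 2) (ring (a * b)) ⟩
    3 * (a * b) + 2           ≤⟨ 3n+2≤5^n (a * b) {{m*n≢0 a b}} ⟩
    y                         ∎
    where
    open ≤-Reasoning
    ring : ∀ x → x + x + x ≡ 3 * x
    ring = solve-∀

  b<K : b < K
  b<K = subst (_≤ K) (m*n/n≡m (suc b) a) (/-monoˡ-≤ a (begin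
    suc b * a      ≡⟨ ring a b ⟩
    a * b + a      ≤⟨ m≤m+n (a * b + a) b ⟩
    n              ∎))
    where
    open ≤-Reasoning
    ring : ∀ a b → (1 + b) * a ≡ a * b + a
    ring = solve-∀

  y^[n%a]<y^a∸1 : y ^ (n % a) < y ^ a ∸ 1
  y^[n%a]<y^a∸1 = ∑y^[f%d]<y^d∸1 1 a (λ _ → n) (≤-trans (+-monoˡ-≤ 2 (≤-trans (s≤s z≤n) b<K)) K+2≤y)

  S<y^b∸1 : S < y ^ b ∸ 1
  S<y^b∸1 = ∑y^[f%d]<y^d∸1 K b e K+2≤y

  instance
    y^a∸1≢0 : NonZero (y ^ a ∸ 1)
    y^a∸1≢0 = >-nonZero (≤-<-trans z≤n y^[n%a]<y^a∸1)
    y^b∸1≢0 : NonZero (y ^ b ∸ 1)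
    y^b∸1≢0 = >-nonZero (≤-<-trans z≤n S<y^b∸1)

  Q = F / (y ^ b ∸ 1)

  y^n/[y^a∸1]≡F : y ^ n / (y ^ a ∸ 1) ≡ F
  y^n/[y^a∸1]≡F = trans (/-congˡ y^n≡y^[n%a]+F*[y^a∸1]) (m<n⇒[m+kn]/n≡k F y^[n%a]<y^a∸1)
    where
    open ≡-Reasoning
    y^n≡y^[n%a]+F*[y^a∸1] : y ^ n ≡ y ^ (n % a) + F * (y ^ a ∸ 1)
    y^n≡y^[n%a]+F*[y^a∸1] = begin
      y ^ n
        ≡⟨ ∑-geometric y a n K aK≤n ⟩
      y ^ (n ∸ a * K) + (∑[ t < K ] y ^ (n ∸ a * suc t)) * (y ^ a ∸ 1)
        ≡⟨ cong₂ (λ r G → y ^ r + G * (y ^ a ∸ 1)) n∸aK≡n%a (∑-cong K (λ t _ → cong (y ^_) (n∸a*[1+t]≡e t))) ⟩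
      y ^ (n % a) + F * (y ^ a ∸ 1)
        ∎
      where
      aK≤n : a * K ≤ n
      aK≤n = subst (_≤ n) (*-comm K a) (m/n*n≤m n a)
      n∸aK≡n%a : n ∸ a * K ≡ n % a
      n∸aK≡n%a = trans (cong (n ∸_) (*-comm a K)) (sym (m%n≡m∸m/n*n n a))

  F+Q≡S+Q*y^b : F + Q ≡ S + Q * y ^ b
  F+Q≡S+Q*y^b = begin
    F + Q                 ≡⟨ cong (_+ Q) (m≡m%n+[m/n]*n F w) ⟩
    F % w + Q * w + Q     ≡⟨ cong (λ r → r + Q * w + Q) F%w≡S ⟩
    S + Q * w + Q         ≡⟨ ring S Q w ⟩
    S + Q * (1 + w)       ≡⟨ cong (λ k → S + Q * k) (m+[n∸m]≡n {1} (m^n>0 y b)) ⟩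
    S + Q * y ^ b         ∎
    where
    open ≡-Reasoning
    w = y ^ b ∸ 1
    F%w≡S : F % w ≡ S
    F%w≡S = trans (∑-cong-% K (λ t _ → y^e%[y^b∸1]≡y^[e%b] y b (e t))) (m<n⇒m%n≡m S<y^b∸1)
    ring : ∀ S Q w → S + Q * w + Q ≡ S + Q * (1 + w)
    ring = solve-∀

  Q%y≡1+g : Q % y ≡ suc g
  Q%y≡1+g = trans (+-cancelˡ-% I I+Q≈I+1+g) (m<n⇒m%n≡m 1+g<y)
    where
    y∣y^b : y ∣ y ^ b
    y∣y^b = subst (λ j → y ∣ y ^ j) (suc-pred b) (m∣m*n (y ^ pred b))
    δ₀[e%b]≡δ₀e+c : ∑[ t < K ] δ₀ (e t % b) ≡ I + ∑ K c
    δ₀[e%b]≡δ₀e+c = trans (∑-cong K (λ t _ → sym (m+[n∸m]≡n (δ₀≤δ₀[%] (e t) b))))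
                          (∑-distrib-+ K (λ t → δ₀ (e t)) c)
    F≈I : F % y ≡ I % y
    F≈I = ∑-cong-% K (λ t _ → m^n%m≡δ₀n%m y (e t))
    S≈∑δ₀[e%b] : S % y ≡ (∑[ t < K ] δ₀ (e t % b)) % y
    S≈∑δ₀[e%b] = ∑-cong-% K (λ t _ → m^n%m≡δ₀n%m y (e t % b))
    I+Q≈I+1+g : (I + Q) % y ≡ (I + suc g) % y
    I+Q≈I+1+g = begin
      (I + Q) % y                   ≡⟨ +-cong-% {x = F} {x′ = I} {z = Q} {z′ = Q} F≈I refl ⟨
      (F + Q) % y                   ≡⟨ %-congˡ F+Q≡S+Q*y^b ⟩
      (S + Q * y ^ b) % y           ≡⟨ %-remove-+ʳ S (∣n⇒∣m*n Q y∣y^b) ⟩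
      S % y                         ≡⟨ S≈∑δ₀[e%b] ⟩
      (∑[ t < K ] δ₀ (e t % b)) % y ≡⟨ %-congˡ δ₀[e%b]≡δ₀e+c ⟩
      (I + ∑ K c) % y               ≡⟨ cong (λ k → (I + k) % y) (∑c≡1+g K b<K) ⟩
      (I + suc g) % y               ∎
      where open ≡-Reasoning
    1+g<y : suc g < y
    1+g<y = begin-strict
      suc g   ≤⟨ s≤s (gcd[m,n]≤n a b) ⟩
      suc b   ≤⟨ b<K ⟩
      K       <⟨ m<m+n K z<s ⟩
      K + 2   ≤⟨ K+2≤y ⟩
      y       ∎
      where open ≤-Reasoning

  floor≡Q : .{{_ : NonZero ((5 ^ (a * a * b) ∸ 1) * (5 ^ (a * b * b) ∸ 1))}} →
            5 ^ (a * b * n) / ((5 ^ (a * a * b) ∸ 1) * (5 ^ (a * b * b) ∸ 1)) ≡ Q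
  floor≡Q = begin
    5 ^ (a * b * n) / ((5 ^ (a * a * b) ∸ 1) * (5 ^ (a * b * b) ∸ 1))
      ≡⟨ /-congˡ (^-*-assoc 5 (a * b) n) ⟨
    y ^ n / ((5 ^ (a * a * b) ∸ 1) * (5 ^ (a * b * b) ∸ 1))
      ≡⟨ /-congʳ (cong₂ (λ u v → (u ∸ 1) * (v ∸ 1)) 5^aab≡y^a (sym (^-*-assoc 5 (a * b) b))) ⟩
    y ^ n / ((y ^ a ∸ 1) * (y ^ b ∸ 1))
      ≡⟨ m/n/o≡m/[n*o] (y ^ n) (y ^ a ∸ 1) (y ^ b ∸ 1) ⟨
    y ^ n / (y ^ a ∸ 1) / (y ^ b ∸ 1)
      ≡⟨ /-congˡ {o = y ^ b ∸ 1} y^n/[y^a∸1]≡F ⟩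
    Q ∎
    where
    open ≡-Reasoning
    instance
      [y^a∸1][y^b∸1]≢0 : NonZero ((y ^ a ∸ 1) * (y ^ b ∸ 1))
      [y^a∸1][y^b∸1]≢0 = m*n≢0 (y ^ a ∸ 1) (y ^ b ∸ 1)
    5^aab≡y^a : 5 ^ (a * a * b) ≡ y ^ a
    5^aab≡y^a = trans (cong (5 ^_) (ring a b)) (sym (^-*-assoc 5 (a * b) a))
      where
      ring : ∀ a b → a * a * b ≡ a * b * a
      ring = solve-∀

theorem1 : (a b : ℕ) → (ha : 1 ≤ a) → (hb : 1 ≤ b) →
    gcd a b ≡ ((_/_ (5 ^ (a * b * (a * b + a + b))) ((5 ^ (a * a * b) ∸ 1) * (5 ^ (a * b * b) ∸ 1)) {{denom-nonZero a b ha hb}}) % (5 ^ (a * b))) {{mod-nonZero a b}} ∸ 1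
theorem1 a b ha hb = sym (begin
  _ % y ∸ 1       ≡⟨ cong (λ q → q % y ∸ 1) (floor≡Q {{denom-nonZero a b ha hb}}) ⟩
  Q % y ∸ 1       ≡⟨ cong (_∸ 1) Q%y≡1+g ⟩
  gcd a b         ∎)
  where
  open ≡-Reasoning
  open Floor a b {{>-nonZero ha}} {{>-nonZero hb}}
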